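{- Let $S=\{e_1<\dots<e_n\}$ be a finite linearly ordered set and let $A,B\subseteq S$ with $|A|=|B|$ and $A\ge B$ in $\mathcal{P}(S)$. Let $\sigma=\sigma_{A,B}$ be the shuffle. If $C\subseteq S$ satisfies $C\ge A$ in $\mathcal{P}(S)$, then $C\ge A$ in $\mathcal{P}(S_\sigma)$.
   Context: $\mathcal{P}(X)$ is the set of subsets of a linearly ordered finite set $X$, ordered by: for $A=\{a_1<\dots<a_k\}$ and $B=\{b_1<\dots<b_m\}$ (sorted in the order of $X$), $A\le B$ iff $m\le k$ and $a_i\le b_i$ for $1\le i\le m$. For $A,B\subseteq S$ with $|A|=|B|$, the shuffle $\sigma_{A,B}$ is the unique permutation of $S$ mapping $B$ onto $A$ and $S\setminus B$ onto $S\setminus A$ whose restrictions to $B$ and $S\setminus B$ are order-preserving. For a permutation $\sigma$ of $S$, $S_\sigma$ is the set $S$ with the linear order $\sigma(e_1)<\dots<\sigma(e_n)$. -}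

module Defs where

open import Data.Nat using (ℕ)
open import Data.Fin using (Fin; _≤_; _<_)
open import Data.Fin.Subset using (Subset; _∈_; _∉_; ∣_∣)
open import Data.Fin.Subset.Properties using (_∈?_)
open import Data.Fin.Permutation using (Permutation′; _⟨$⟩ʳ_; _⟨$⟩ˡ_; id)
open import Data.List using (List; []; _∷_; filter; map; allFin)
open import Data.Unit using (⊤)
open import Data.Empty using (⊥)
open import Data.Product using (_×_)

-- The underlying finite set S = {e_1 < ... < e_n} is modelled as Fin n.
-- A linear order on S is given by a permutation π: the order is
--   π(e_1) < π(e_2) < ... < π(e_n),   i.e. the order of S_π.
-- The original order of S is S_id.

_≤[_]_ : {n : ℕ} → Fin n → Permutation′ n → Fin n → Set
x ≤[ π ] y = (π ⟨$⟩ˡ x) ≤ (π ⟨$⟩ˡ y)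

sorted : {n : ℕ} → Permutation′ n → Subset n → List (Fin n)
sorted {n} π C = map (π ⟨$⟩ʳ_) (filter (λ i → (π ⟨$⟩ʳ i) ∈? C) (allFin n))

PairwiseLe : {A : Set} → (A → A → Set) → List A → List A → Set
PairwiseLe R as       []       = ⊤
PairwiseLe R []       (b ∷ bs) = ⊥
PairwiseLe R (a ∷ as) (b ∷ bs) = R a b × PairwiseLe R as bs

_≤𝒫[_]_ : {n : ℕ} → Subset n → Permutation′ n → Subset n → Set
A ≤𝒫[ π ] B = PairwiseLe (λ a b → a ≤[ π ] b) (sorted π A) (sorted π B)

_≤𝒫_ : {n : ℕ} → Subset n → Subset n → Set
A ≤𝒫 B = A ≤𝒫[ id ] B

-- σ is the shuffle σ_{A,B}: a permutation of S mapping B onto A and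
-- S∖B onto S∖A, order-preserving (w.r.t. the order of S) on B and on S∖B.
-- (Since σ is a bijection, "into" for both parts gives "onto"; such σ is unique.)
IsShuffle : {n : ℕ} → Subset n → Subset n → Permutation′ n → Set
IsShuffle A B σ =
  (∀ x → x ∈ B → (σ ⟨$⟩ʳ x) ∈ A) ×
  (∀ x → x ∉ B → (σ ⟨$⟩ʳ x) ∉ A) ×
  (∀ x y → x ∈ B → y ∈ B → x < y → (σ ⟨$⟩ʳ x) < (σ ⟨$⟩ʳ y)) ×
  (∀ x y → x ∉ B → y ∉ B → x < y → (σ ⟨$⟩ʳ x) < (σ ⟨$⟩ʳ y))

-- Order 𝒫(S_π) by counting: X ≤ Y iff every initial segment of S_π contains
-- at most as many elements of Y as of X.  Read this way, B ≤ A says that the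
-- shuffle σ moves every element of B up and every element of S∖B down, so
-- σ b ≤ σ y forces b ≤ y whenever b ∈ B.  Consequently the image T of an
-- initial segment of S_σ is closed downwards relative to A: an element of A
-- below some element of T lies in T.  With m the largest element of T this gives
-- |C ∩ T| ≤ |C ∩ ↓m| ≤ |A ∩ ↓m| ≤ |A ∩ T|, which is C ≥ A counted in S_σ.
module Submission where

open import Defs
open import Data.Nat using (ℕ)
open import Data.Fin.Subset using (Subset; ∣_∣)
open import Data.Fin.Permutation using (Permutation′)
open import Relation.Binary.PropositionalEquality using (_≡_)

open import Data.Empty using (⊥-elim)
open import Data.Fin using (Fin; zero; suc; _≤_; _<_)
open import Data.Fin.Permutation using (_⟨$⟩ʳ_; _⟨$⟩ˡ_; inverseˡ; inverseʳ; id; flip)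
open import Data.Fin.Properties using (_≤?_; ≤-refl; ≤-trans; toℕ-injective)
open import Data.Fin.Subset using (_∈_; _∉_)
open import Data.Fin.Subset.Properties using (_∈?_)
open import Data.List using (List; []; _∷_; filter; map; allFin; tabulate; length)
open import Data.List.Properties using (filter-accept; filter-reject; filter-none)
import Data.List.Relation.Unary.All as All
open import Data.List.Relation.Unary.AllPairs using (AllPairs; _∷_)
import Data.List.Relation.Unary.AllPairs.Properties as AllPairs
open import Data.Nat as ℕ using (zero; suc; _+_; z≤n; s≤s)
import Data.Nat.Properties as ℕ
open import Algebra.Properties.CommutativeMonoid.Sum ℕ.+-0-commutativeMonoid
  using (sum; sum-permute; ∑-distrib-+; sum-cong-≗)
open import Data.Product using (_×_; _,_; ∃; proj₁; proj₂)
open import Data.Sum using (_⊎_; inj₁; inj₂)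
open import Data.Unit using (tt)
open import Function using (_∘_; _⇔_; mk⇔; Equivalence)
open import Level using (Level)
open import Relation.Binary.PropositionalEquality
  using (refl; sym; trans; cong; subst; subst₂; module ≡-Reasoning)
open import Relation.Nullary using (Dec; yes; no; ¬_)
open import Relation.Unary using (Pred; Decidable; _⊆_; _≐_)
open import Relation.Unary.Properties using (_∩?_; ∁?)

private
  variable
    p q t : Level

indicator : ∀ {P : Set p} → Dec P → ℕ
indicator (yes _) = 1
indicator (no _)  = 0

indicator-mono : ∀ {P : Set p} {Q : Set q} → (P → Q) → (P? : Dec P) (Q? : Dec Q) →
                 indicator P? ℕ.≤ indicator Q?
indicator-mono P⇒Q (yes _) (yes _) = ℕ.≤-refl
indicator-mono P⇒Q (yes p) (no ¬q) = ⊥-elim (¬q (P⇒Q p))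
indicator-mono P⇒Q (no _)  _       = z≤n

count : ∀ {n} {P : Pred (Fin n) p} → Decidable P → ℕ
count P? = sum (indicator ∘ P?)

count-mono : ∀ {n} {P : Pred (Fin n) p} {Q : Pred (Fin n) q} {P? : Decidable P} {Q? : Decidable Q} →
             P ⊆ Q → count P? ℕ.≤ count Q?
count-mono {n = zero}  _ = z≤n
count-mono {n = suc n} {P? = P?} {Q?} P⊆Q =
  ℕ.+-mono-≤ (indicator-mono P⊆Q (P? zero) (Q? zero)) (count-mono {P? = P? ∘ suc} {Q? ∘ suc} P⊆Q)

count-mono-< : ∀ {n} {P : Pred (Fin n) p} {Q : Pred (Fin n) q} {P? : Decidable P} {Q? : Decidable Q} →
               P ⊆ Q → ∀ {x} → Q x → ¬ P x → count P? ℕ.< count Q?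
count-mono-< {n = suc n} {P? = P?} {Q?} P⊆Q {zero} Qx ¬Px with P? zero | Q? zero
... | yes Px | _      = ⊥-elim (¬Px Px)
... | no _   | no ¬Qx = ⊥-elim (¬Qx Qx)
... | no _   | yes _  = s≤s (count-mono {P? = P? ∘ suc} {Q? ∘ suc} P⊆Q)
count-mono-< {n = suc n} {P? = P?} {Q?} P⊆Q {suc x} Qx ¬Px =
  ℕ.+-mono-≤-< (indicator-mono P⊆Q (P? zero) (Q? zero))
               (count-mono-< {P? = P? ∘ suc} {Q? ∘ suc} P⊆Q Qx ¬Px)

count-cong : ∀ {n} {P : Pred (Fin n) p} {Q : Pred (Fin n) q} {P? : Decidable P} {Q? : Decidable Q} →
             P ≐ Q → count P? ≡ count Q?
count-cong {P? = P?} {Q?} (P⊆Q , Q⊆P) =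
  ℕ.≤-antisym (count-mono {P? = P?} {Q?} P⊆Q) (count-mono {P? = Q?} {P?} Q⊆P)

count-split : ∀ {n} {P : Pred (Fin n) p} {Q : Pred (Fin n) q} (P? : Decidable P) (Q? : Decidable Q) →
              count Q? ≡ count (P? ∩? Q?) + count (∁? P? ∩? Q?)
count-split P? Q? =
  trans (sum-cong-≗ split) (∑-distrib-+ (indicator ∘ (P? ∩? Q?)) (indicator ∘ (∁? P? ∩? Q?)))
  where
  split : ∀ i → indicator (Q? i) ≡ indicator ((P? ∩? Q?) i) + indicator ((∁? P? ∩? Q?) i)
  split i with P? i | Q? i
  ... | yes _ | yes _ = refl
  ... | yes _ | no _  = refl
  ... | no _  | yes _ = refl
  ... | no _  | no _  = refl

count-permute : ∀ {n} {P : Pred (Fin n) p} (P? : Decidable P) (π : Permutation′ n) →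
                count P? ≡ count (P? ∘ (π ⟨$⟩ʳ_))
count-permute P? π = sum-permute (indicator ∘ P?) π

count-∩-permute : ∀ {n} {P : Pred (Fin n) p} {Q : Pred (Fin n) q}
                  (π : Permutation′ n) (P? : Decidable P) (Q? : Decidable Q) →
                  count ((P? ∘ (π ⟨$⟩ʳ_)) ∩? Q?) ≡ count (P? ∩? (Q? ∘ (π ⟨$⟩ˡ_)))
count-∩-permute {Q = Q} π P? Q? = begin
  count ((P? ∘ (π ⟨$⟩ʳ_)) ∩? Q?)                ≡⟨ count-cong {P? = (P? ∘ (π ⟨$⟩ʳ_)) ∩? Q?}
                                                              {(P? ∩? (Q? ∘ (π ⟨$⟩ˡ_))) ∘ (π ⟨$⟩ʳ_)}
                                                      ( (λ (Pπx , Qx) → Pπx , subst Q (sym (inverseˡ π)) Qx)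
                                                      , (λ (Pπx , Qx) → Pπx , subst Q (inverseˡ π) Qx)) ⟩
  count ((P? ∩? (Q? ∘ (π ⟨$⟩ˡ_))) ∘ (π ⟨$⟩ʳ_))  ≡⟨ count-permute (P? ∩? (Q? ∘ (π ⟨$⟩ˡ_))) π ⟨
  count (P? ∩? (Q? ∘ (π ⟨$⟩ˡ_)))                ∎
  where open ≡-Reasoning

_≤ᶜ_ : ∀ {n} {P : Pred (Fin n) p} {Q : Pred (Fin n) q} → Decidable P → Decidable Q → Set
_≤ᶜ_ {n = n} P? Q? = ∀ (j : Fin n) → count (Q? ∩? (_≤? j)) ℕ.≤ count (P? ∩? (_≤? j))

≤ᶜ-∁ : ∀ {n} {P : Pred (Fin n) p} {Q : Pred (Fin n) q} {P? : Decidable P} {Q? : Decidable Q} →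
       P? ≤ᶜ Q? → ∁? Q? ≤ᶜ ∁? P?
≤ᶜ-∁ {P? = P?} {Q?} P≤Q j = ℕ.+-cancelˡ-≤ (count (P? ∩? ↓j)) _ _ (begin
  count (P? ∩? ↓j) + count (∁? P? ∩? ↓j)  ≡⟨ count-split P? ↓j ⟨
  count ↓j                                ≡⟨ count-split Q? ↓j ⟩
  count (Q? ∩? ↓j) + count (∁? Q? ∩? ↓j)  ≤⟨ ℕ.+-monoˡ-≤ _ (P≤Q j) ⟩
  count (P? ∩? ↓j) + count (∁? Q? ∩? ↓j)  ∎)
  where
  open ℕ.≤-Reasoning
  ↓j : Decidable (_≤ j)
  ↓j = _≤? j

largest : ∀ {n} {P : Pred (Fin n) p} → Decidable P →
          (∀ i → ¬ P i) ⊎ ∃ λ m → P m × (∀ {i} → P i → i ≤ m)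
largest {n = zero} P? = inj₁ λ ()
largest {n = suc n} P? with largest (P? ∘ suc)
... | inj₂ (m , Pm , m-max) = inj₂ (suc m , Pm , λ { {zero} _ → z≤n ; {suc i} Pi → s≤s (m-max Pi) })
... | inj₁ none with P? zero
...   | yes P0 = inj₂ (zero , P0 , λ { {zero} _ → z≤n ; {suc i} Pi → ⊥-elim (none i Pi) })
...   | no ¬P0 = inj₁ λ { zero → ¬P0 ; (suc i) → none i }

≤ᶜ-on-down-closed : ∀ {n} {P : Pred (Fin n) p} {Q : Pred (Fin n) q} {T : Pred (Fin n) t}
            {P? : Decidable P} {Q? : Decidable Q} (T? : Decidable T) →
            P? ≤ᶜ Q? → (∀ {x y} → T x → P y → y ≤ x → T y) →
            count (Q? ∩? T?) ℕ.≤ count (P? ∩? T?)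
≤ᶜ-on-down-closed {P? = P?} {Q?} T? P≤Q T-closed with largest T?
... | inj₁ none = count-mono {P? = Q? ∩? T?} {P? ∩? T?} λ (_ , Tx) → ⊥-elim (none _ Tx)
... | inj₂ (m , Tm , m-max) = begin
  count (Q? ∩? T?)       ≤⟨ count-mono {P? = Q? ∩? T?} {Q? ∩? (_≤? m)} (λ (Qx , Tx) → Qx , m-max Tx) ⟩
  count (Q? ∩? (_≤? m))  ≤⟨ P≤Q m ⟩
  count (P? ∩? (_≤? m))  ≤⟨ count-mono {P? = P? ∩? (_≤? m)} {P? ∩? T?}
                               (λ (Px , x≤m) → Px , T-closed Tm Px x≤m) ⟩
  count (P? ∩? T?)       ∎
  where open ℕ.≤-Reasoning

-- If π x < x, the segment ↓(π x) meets Q more often than P.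
≤ᶜ⇒inflationary : ∀ {n} {P : Pred (Fin n) p} {Q : Pred (Fin n) q}
                  {P? : Decidable P} {Q? : Decidable Q} (π : Permutation′ n) →
                  (∀ {x} → P x → Q (π ⟨$⟩ʳ x)) →
                  (∀ {x y} → P x → P y → x ≤ y → π ⟨$⟩ʳ x ≤ π ⟨$⟩ʳ y) →
                  P? ≤ᶜ Q? → ∀ {x} → P x → x ≤ π ⟨$⟩ʳ x
≤ᶜ⇒inflationary {P? = P?} {Q?} π maps-to mono P≤Q {x} Px with x ≤? π ⟨$⟩ʳ x
... | yes x≤πx = x≤πx
... | no x≰πx = ⊥-elim (ℕ.<-irrefl refl (begin-strict
  count (P? ∩? (_≤? πx))               <⟨ count-mono-< {P? = P? ∩? (_≤? πx)} {P? ∩? (_≤? x)}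
                                            (λ (Py , y≤πx) → Py , ℕ.≤-trans y≤πx (ℕ.<⇒≤ πx<x))
                                            (Px , ℕ.≤-refl) (λ (_ , x≤πx) → x≰πx x≤πx) ⟩
  count (P? ∩? (_≤? x))                ≤⟨ count-mono {P? = P? ∩? (_≤? x)} {(Q? ∩? (_≤? πx)) ∘ (π ⟨$⟩ʳ_)}
                                            (λ (Py , y≤x) → maps-to Py , mono Py Px y≤x) ⟩
  count ((Q? ∩? (_≤? πx)) ∘ (π ⟨$⟩ʳ_))  ≡⟨ count-permute (Q? ∩? (_≤? πx)) π ⟨
  count (Q? ∩? (_≤? πx))               ≤⟨ P≤Q πx ⟩
  count (P? ∩? (_≤? πx))               ∎))
  where
  open ℕ.≤-Reasoning
  πx = π ⟨$⟩ʳ x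
  πx<x : πx < x
  πx<x = ℕ.≰⇒> x≰πx

StrictlyMonotoneOn : ∀ {n} → Pred (Fin n) p → (Fin n → Fin n) → Set p
StrictlyMonotoneOn X f = ∀ x y → X x → X y → x < y → f x < f y

module _ {n} {X : Pred (Fin n) p} {f : Fin n → Fin n} (f-mono : StrictlyMonotoneOn X f) where

  strictlyMonotoneOn⇒monotoneOn : ∀ {x y} → X x → X y → x ≤ y → f x ≤ f y
  strictlyMonotoneOn⇒monotoneOn {x} {y} Xx Xy x≤y with ℕ.m≤n⇒m<n∨m≡n x≤y
  ... | inj₁ x<y = ℕ.<⇒≤ (f-mono x y Xx Xy x<y)
  ... | inj₂ x≡y rewrite toℕ-injective x≡y = ≤-refl

  strictlyMonotoneOn⇒reflects-≤ : ∀ {x y} → X x → X y → f x ≤ f y → x ≤ y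
  strictlyMonotoneOn⇒reflects-≤ {x} {y} Xx Xy fx≤fy with x ≤? y
  ... | yes x≤y = x≤y
  ... | no x≰y  = ⊥-elim (ℕ.<⇒≱ (f-mono y x Xy Xx (ℕ.≰⇒> x≰y)) fx≤fy)

module _ {a} {A : Set a} where

  filter-filter : ∀ {P : Pred A p} {Q : Pred A q} (P? : Decidable P) (Q? : Decidable Q) xs →
                  filter P? (filter Q? xs) ≡ filter (Q? ∩? P?) xs
  filter-filter P? Q? [] = refl
  filter-filter P? Q? (x ∷ xs) with Q? x
  ... | no _  = filter-filter P? Q? xs
  ... | yes _ with P? x
  ...   | yes _ = cong (x ∷_) (filter-filter P? Q? xs)
  ...   | no _  = filter-filter P? Q? xs

  length-filter-tabulate : ∀ {n} {P : Pred A p} (P? : Decidable P) (f : Fin n → A) →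
                           length (filter P? (tabulate f)) ≡ count (P? ∘ f)
  length-filter-tabulate {n = zero}  P? f = refl
  length-filter-tabulate {n = suc n} P? f with P? (f zero)
  ... | yes _ = cong suc (length-filter-tabulate P? (f ∘ suc))
  ... | no _  = length-filter-tabulate P? (f ∘ suc)

module _ {A B : Set} {R : B → B → Set} {S : A → A → Set} (f : A → B) where

  PairwiseLe-map⁺ : (∀ {x y} → S x y → R (f x) (f y)) →
                    ∀ xs ys → PairwiseLe S xs ys → PairwiseLe R (map f xs) (map f ys)
  PairwiseLe-map⁺ S⇒R xs       []       _             = tt
  PairwiseLe-map⁺ S⇒R (x ∷ xs) (y ∷ ys) (Sxy , xs≤ys) = S⇒R Sxy , PairwiseLe-map⁺ S⇒R xs ys xs≤ys

  PairwiseLe-map⁻ : (∀ {x y} → R (f x) (f y) → S x y) →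
                    ∀ xs ys → PairwiseLe R (map f xs) (map f ys) → PairwiseLe S xs ys
  PairwiseLe-map⁻ R⇒S xs       []       _             = tt
  PairwiseLe-map⁻ R⇒S (x ∷ xs) (y ∷ ys) (Rxy , xs≤ys) = R⇒S Rxy , PairwiseLe-map⁻ R⇒S xs ys xs≤ys

#≤ : ∀ {n} → List (Fin n) → Fin n → ℕ
#≤ xs j = length (filter (_≤? j) xs)

module _ {n : ℕ} where

  #≤-∷-≤ : ∀ {j x : Fin n} {xs} → x ≤ j → #≤ (x ∷ xs) j ≡ suc (#≤ xs j)
  #≤-∷-≤ x≤j = cong length (filter-accept (_≤? _) x≤j)

  #≤-∷-≰ : ∀ {j x : Fin n} {xs} → ¬ x ≤ j → #≤ (x ∷ xs) j ≡ #≤ xs j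
  #≤-∷-≰ x≰j = cong length (filter-reject (_≤? _) x≰j)

  #≤-∷-pos : ∀ {x : Fin n} {xs} → 0 ℕ.< #≤ (x ∷ xs) x
  #≤-∷-pos {x} {xs} rewrite #≤-∷-≤ {xs = xs} (≤-refl {x = x}) = s≤s z≤n

  #≤-above : ∀ {j x : Fin n} {xs} → j < x → AllPairs _<_ (x ∷ xs) → #≤ xs j ≡ 0
  #≤-above j<x (x<xs ∷ _) =
    cong length (filter-none (_≤? _) (All.map (λ x<y → ℕ.<⇒≱ (ℕ.<-trans j<x x<y)) x<xs))

  PairwiseLe⇒#≤ : ∀ {xs ys : List (Fin n)} → AllPairs _<_ ys → PairwiseLe _≤_ xs ys →
                  ∀ j → #≤ ys j ℕ.≤ #≤ xs j
  PairwiseLe⇒#≤ {ys = []} _ _ j = z≤n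
  PairwiseLe⇒#≤ {x ∷ xs} {y ∷ ys} ys↑@(_ ∷ ys↑′) (x≤y , xs≤ys) j with y ≤? j
  ... | yes y≤j rewrite #≤-∷-≤ {xs = ys} y≤j | #≤-∷-≤ {xs = xs} (≤-trans x≤y y≤j) =
    s≤s (PairwiseLe⇒#≤ ys↑′ xs≤ys j)
  ... | no y≰j rewrite #≤-∷-≰ {xs = ys} y≰j | #≤-above (ℕ.≰⇒> y≰j) ys↑ = z≤n

  #≤⇒PairwiseLe : ∀ {xs ys : List (Fin n)} → AllPairs _<_ xs → AllPairs _<_ ys →
                  (∀ j → #≤ ys j ℕ.≤ #≤ xs j) → PairwiseLe _≤_ xs ys
  #≤⇒PairwiseLe {ys = []} _ _ _ = tt
  #≤⇒PairwiseLe {[]} {y ∷ ys} _ _ ys≤xs = ℕ.n≮0 (ℕ.<-≤-trans (#≤-∷-pos {y} {ys}) (ys≤xs y))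
  #≤⇒PairwiseLe {x ∷ xs} {y ∷ ys} xs↑@(_ ∷ xs↑′) ys↑@(_ ∷ ys↑′) ys≤xs =
    x≤y , #≤⇒PairwiseLe xs↑′ ys↑′ tail≤
    where
    x≤y : x ≤ y
    x≤y with x ≤? y
    ... | yes x≤y = x≤y
    ... | no x≰y  = ⊥-elim (ℕ.n≮0 (begin-strict
      0              <⟨ #≤-∷-pos {y} {ys} ⟩
      #≤ (y ∷ ys) y  ≤⟨ ys≤xs y ⟩
      #≤ (x ∷ xs) y  ≡⟨ #≤-∷-≰ x≰y ⟩
      #≤ xs y        ≡⟨ #≤-above (ℕ.≰⇒> x≰y) xs↑ ⟩
      0              ∎))
      where open ℕ.≤-Reasoning
    tail≤ : ∀ j → #≤ ys j ℕ.≤ #≤ xs j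
    tail≤ j with y ≤? j
    ... | yes y≤j = ℕ.s≤s⁻¹ (begin
      suc (#≤ ys j)  ≡⟨ #≤-∷-≤ y≤j ⟨
      #≤ (y ∷ ys) j  ≤⟨ ys≤xs j ⟩
      #≤ (x ∷ xs) j  ≡⟨ #≤-∷-≤ (≤-trans x≤y y≤j) ⟩
      suc (#≤ xs j)  ∎)
      where open ℕ.≤-Reasoning
    ... | no y≰j rewrite #≤-above (ℕ.≰⇒> y≰j) ys↑ = z≤n

module _ {n : ℕ} (π : Permutation′ n) where

  positions : Subset n → List (Fin n)
  positions X = filter ((_∈? X) ∘ (π ⟨$⟩ʳ_)) (allFin n)

  positions-sorted : ∀ X → AllPairs _<_ (positions X)
  positions-sorted X = AllPairs.filter⁺ _ (AllPairs.tabulate⁺-< (λ i<j → i<j))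

  #≤-positions : ∀ X j → #≤ (positions X) j ≡ count (((_∈? X) ∘ (π ⟨$⟩ʳ_)) ∩? (_≤? j))
  #≤-positions X j =
    trans (cong length (filter-filter (_≤? j) ((_∈? X) ∘ (π ⟨$⟩ʳ_)) (allFin n)))
          (length-filter-tabulate (((_∈? X) ∘ (π ⟨$⟩ʳ_)) ∩? (_≤? j)) (λ i → i))

  ≤𝒫[]⇔≤ᶜ : ∀ {X Y} → X ≤𝒫[ π ] Y ⇔ ((_∈? X) ∘ (π ⟨$⟩ʳ_)) ≤ᶜ ((_∈? Y) ∘ (π ⟨$⟩ʳ_))
  ≤𝒫[]⇔≤ᶜ {X} {Y} = mk⇔
    (λ X≤Y j → subst₂ ℕ._≤_ (#≤-positions Y j) (#≤-positions X j)
      (PairwiseLe⇒#≤ (positions-sorted Y)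
        (PairwiseLe-map⁻ (π ⟨$⟩ʳ_) (subst₂ _≤_ (inverseˡ π) (inverseˡ π)) (positions X) (positions Y) X≤Y)
        j))
    (λ X≤Y → PairwiseLe-map⁺ (π ⟨$⟩ʳ_) (subst₂ _≤_ (sym (inverseˡ π)) (sym (inverseˡ π)))
      (positions X) (positions Y)
      (#≤⇒PairwiseLe (positions-sorted X) (positions-sorted Y)
        (λ j → subst₂ ℕ._≤_ (sym (#≤-positions Y j)) (sym (#≤-positions X j)) (X≤Y j))))

module Shuffle {n} (A B : Subset n) (σ : Permutation′ n)
               (shuffle : IsShuffle A B σ) (B≤A : (_∈? B) ≤ᶜ (_∈? A)) where

  σB⊆A : ∀ {x} → x ∈ B → σ ⟨$⟩ʳ x ∈ A
  σB⊆A = proj₁ shuffle _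

  σ∁B⊆∁A : ∀ {x} → x ∉ B → σ ⟨$⟩ʳ x ∉ A
  σ∁B⊆∁A = proj₁ (proj₂ shuffle) _

  σ-mono-B : StrictlyMonotoneOn (_∈ B) (σ ⟨$⟩ʳ_)
  σ-mono-B = proj₁ (proj₂ (proj₂ shuffle))

  σ-mono-∁B : StrictlyMonotoneOn (_∉ B) (σ ⟨$⟩ʳ_)
  σ-mono-∁B = proj₂ (proj₂ (proj₂ shuffle))

  σ⁻¹A⊆B : ∀ {x} → x ∈ A → σ ⟨$⟩ˡ x ∈ B
  σ⁻¹A⊆B {x} x∈A with σ ⟨$⟩ˡ x ∈? B
  ... | yes σ⁻¹x∈B = σ⁻¹x∈B
  ... | no σ⁻¹x∉B  = ⊥-elim (σ∁B⊆∁A σ⁻¹x∉B (subst (_∈ A) (sym (inverseʳ σ)) x∈A))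

  σ⁻¹∁A⊆∁B : ∀ {x} → x ∉ A → σ ⟨$⟩ˡ x ∉ B
  σ⁻¹∁A⊆∁B x∉A σ⁻¹x∈B = x∉A (subst (_∈ A) (inverseʳ σ) (σB⊆A σ⁻¹x∈B))

  B-inflationary : ∀ {x} → x ∈ B → x ≤ σ ⟨$⟩ʳ x
  B-inflationary =
    ≤ᶜ⇒inflationary {P? = _∈? B} {Q? = _∈? A} σ σB⊆A (strictlyMonotoneOn⇒monotoneOn σ-mono-B) B≤A

  ∁B-deflationary : ∀ {x} → x ∉ B → σ ⟨$⟩ʳ x ≤ x
  ∁B-deflationary x∉B = subst (_ ≤_) (inverseˡ σ) (∁A-inflationary (σ∁B⊆∁A x∉B))
    where
    σ⁻¹-mono-∁A : ∀ {x y} → x ∉ A → y ∉ A → x ≤ y → σ ⟨$⟩ˡ x ≤ σ ⟨$⟩ˡ y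
    σ⁻¹-mono-∁A x∉A y∉A x≤y =
      strictlyMonotoneOn⇒reflects-≤ σ-mono-∁B (σ⁻¹∁A⊆∁B x∉A) (σ⁻¹∁A⊆∁B y∉A)
        (subst₂ _≤_ (sym (inverseʳ σ)) (sym (inverseʳ σ)) x≤y)
    ∁A-inflationary : ∀ {x} → x ∉ A → x ≤ σ ⟨$⟩ˡ x
    ∁A-inflationary = ≤ᶜ⇒inflationary {P? = ∁? (_∈? A)} {Q? = ∁? (_∈? B)} (flip σ)
      σ⁻¹∁A⊆∁B σ⁻¹-mono-∁A (≤ᶜ-∁ {P? = _∈? B} {Q? = _∈? A} B≤A)

  σ-reflects-≤ : ∀ {x y} → x ∈ B → σ ⟨$⟩ʳ x ≤ σ ⟨$⟩ʳ y → x ≤ y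
  σ-reflects-≤ {x} {y} x∈B σx≤σy with y ∈? B
  ... | yes y∈B = strictlyMonotoneOn⇒reflects-≤ σ-mono-B x∈B y∈B σx≤σy
  ... | no y∉B  = ≤-trans (B-inflationary x∈B) (≤-trans σx≤σy (∁B-deflationary y∉B))

  σ⁻¹-down-closed : ∀ j {x y} → σ ⟨$⟩ˡ x ≤ j → y ∈ A → y ≤ x → σ ⟨$⟩ˡ y ≤ j
  σ⁻¹-down-closed j σ⁻¹x≤j y∈A y≤x =
    ≤-trans (σ-reflects-≤ (σ⁻¹A⊆B y∈A) (subst₂ _≤_ (sym (inverseʳ σ)) (sym (inverseʳ σ)) y≤x)) σ⁻¹x≤j

  ≤ᶜ-shuffle : ∀ {C} → (_∈? A) ≤ᶜ (_∈? C) → ((_∈? A) ∘ (σ ⟨$⟩ʳ_)) ≤ᶜ ((_∈? C) ∘ (σ ⟨$⟩ʳ_))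
  ≤ᶜ-shuffle {C} A≤C j = begin
    count (((_∈? C) ∘ (σ ⟨$⟩ʳ_)) ∩? (_≤? j))  ≡⟨ count-∩-permute σ (_∈? C) (_≤? j) ⟩
    count ((_∈? C) ∩? ((_≤? j) ∘ (σ ⟨$⟩ˡ_)))  ≤⟨ ≤ᶜ-on-down-closed {P? = _∈? A} {Q? = _∈? C}
                                                   ((_≤? j) ∘ (σ ⟨$⟩ˡ_)) A≤C (σ⁻¹-down-closed j) ⟩
    count ((_∈? A) ∩? ((_≤? j) ∘ (σ ⟨$⟩ˡ_)))  ≡⟨ count-∩-permute σ (_∈? A) (_≤? j) ⟨
    count (((_∈? A) ∘ (σ ⟨$⟩ʳ_)) ∩? (_≤? j))  ∎
    where open ℕ.≤-Reasoning

lemma7p2 : (n : ℕ) (A B C : Subset n) (σ : Permutation′ n) →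
    ∣ A ∣ ≡ ∣ B ∣ → B ≤𝒫 A → IsShuffle A B σ →
    A ≤𝒫 C → A ≤𝒫[ σ ] C
lemma7p2 n A B C σ _ B≤A shuffle A≤C =
  Equivalence.from (≤𝒫[]⇔≤ᶜ σ) (≤ᶜ-shuffle (Equivalence.to (≤𝒫[]⇔≤ᶜ id {A} {C}) A≤C))
  where open Shuffle A B σ shuffle (Equivalence.to (≤𝒫[]⇔≤ᶜ id {B} {A}) B≤A)
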